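{- Let $r\geqslant 3$ and $t\geqslant 2$ be integers. There exist positive constants $c=c(r,t)$ and $d=d(r,t)$ such that the following holds for all integers $k\geqslant r+t$ and $n\geqslant ck^d$. Let $\mathcal{F}\subseteq\binom{[n]}{k}$ be an $r$-wise $t$-intersecting family with $\tau_t(\mathcal{F})=t+1$, and let $G$ be the $(t+1)$-uniform hypergraph whose edges are the $t$-covers of $\mathcal{F}$ of size $t+1$ and whose vertex set is the union of these edges. Suppose every connected component of $G$ is a clique. If $G$ has a connected component with more than $r+t$ vertices, then $N_{r+1,t}(\mathcal{F})<N_{r+1,t}(\mathcal{G}_{r,t})$.
   Context: $\binom{[n]}{k}$ is the family of $k$-subsets of $[n]=\{1,\dots,n\}$. A family is $r$-wise $t$-intersecting if any $r$ of its members (not necessarily distinct) share at least $t$ elements. A set $T\subseteq[n]$ is a $t$-cover of $\mathcal{F}$ if $|T\cap F|\geqslant t$ for all $F\in\mathcal{F}$; $\tau_t(\mathcal{F})$ is the minimum size of a $t$-cover. A connected component $H$ of $G$ (with vertex set $V(H)$) is a clique if its edge set is $\binom{V(H)}{t+1}$. A $(r+1,t)$-triangle is a family $\{T_1,\dots,T_{r+1}\}$ of $r+1$ sets which is $r$-wise $t$-intersecting with $|T_1\cap\cdots\cap T_{r+1}|\leqslant t-1$; $N_{r+1,t}(\mathcal{F})$ is the number of $(r+1)$-element subfamilies of $\mathcal{F}$ that are $(r+1,t)$-triangles. $\mathcal{G}_{r,t}=\{F\in\binom{[n]}{k}: |F\cap[r+t]|=r+t-1\}$. -}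

module Defs where

open import Data.Nat using (ℕ; zero; suc; _+_; _*_; _^_; _≤_; _<_; _∸_; _≤ᵇ_; _<ᵇ_)
open import Data.Bool using (Bool; true; false; _∧_)
open import Data.List using (List; []; _∷_; map; _++_; concatMap; length; filterᵇ)
open import Data.List.Relation.Unary.All using (All)
open import Data.List.Relation.Unary.Unique.Propositional using (Unique)
open import Data.List.Membership.Propositional using () renaming (_∈_ to _∈ₗ_)
open import Data.Fin using (Fin; toℕ)
open import Data.Fin.Subset using (Subset; _∩_; ⋂; ∣_∣; _∈_; _⊆_; inside; outside)
open import Data.Vec using (Vec; []; _∷_; tabulate)
open import Data.Product using (Σ; _×_; ∃; ∃-syntax)

tuples : {A : Set} → ℕ → List A → List (List A)
tuples zero    L = [] ∷ []
tuples (suc m) L = concatMap (λ x → map (x ∷_) (tuples m L)) L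

combinations : {A : Set} → ℕ → List A → List (List A)
combinations zero    L       = [] ∷ []
combinations (suc m) []      = []
combinations (suc m) (x ∷ L) = map (x ∷_) (combinations m L) ++ combinations (suc m) L

allSubsets : (n : ℕ) → List (Subset n)
allSubsets zero    = [] ∷ []
allSubsets (suc n) = map (inside ∷_) (allSubsets n) ++ map (outside ∷_) (allSubsets n)

-- Families of subsets of [n] are duplicate-free lists of subsets.

IsKUniformFamily : (n k : ℕ) → List (Subset n) → Set
IsKUniformFamily n k 𝓕 = Unique 𝓕 × All (λ A → ∣ A ∣ ≡ k) 𝓕
  where open import Relation.Binary.PropositionalEquality using (_≡_)

-- r-wise t-intersecting: any r members (not necessarily distinct) share ≥ t elements
rwiseIntᵇ : {n : ℕ} → ℕ → ℕ → List (Subset n) → Bool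
rwiseIntᵇ r t 𝓕 = go (tuples r 𝓕)
  where
  go : List (List (Subset _)) → Bool
  go []       = true
  go (S ∷ Ss) = (t ≤ᵇ ∣ ⋂ S ∣) ∧ go Ss

RWiseTIntersecting : {n : ℕ} → ℕ → ℕ → List (Subset n) → Set
RWiseTIntersecting r t 𝓕 =
  (S : List (Subset _)) → length S ≡ r → All (_∈ₗ 𝓕) S → t ≤ ∣ ⋂ S ∣
  where open import Relation.Binary.PropositionalEquality using (_≡_)

IsTCover : {n : ℕ} → ℕ → List (Subset n) → Subset n → Set
IsTCover t 𝓕 T = All (λ F → t ≤ ∣ T ∩ F ∣) 𝓕

TauEq : {n : ℕ} → ℕ → List (Subset n) → ℕ → Set
TauEq t 𝓕 m =
  (∃[ T ] (IsTCover t 𝓕 T × ∣ T ∣ ≡ m)) × (∀ T → IsTCover t 𝓕 T → m ≤ ∣ T ∣)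
  where open import Relation.Binary.PropositionalEquality using (_≡_)

module CoverGraph {n : ℕ} (t : ℕ) (𝓕 : List (Subset n)) where
  open import Relation.Binary.PropositionalEquality using (_≡_)

  Edge : Subset n → Set
  Edge E = IsTCover t 𝓕 E × ∣ E ∣ ≡ suc t

  Vertex : Fin n → Set
  Vertex v = ∃[ E ] (Edge E × v ∈ E)

  data Conn (u : Fin n) : Fin n → Set where
    here : Vertex u → Conn u u
    step : ∀ {w v} E → Conn u w → Edge E → w ∈ E → v ∈ E → Conn u v

  AllComponentsCliques : Set
  AllComponentsCliques =
    ∀ v → Vertex v → ∀ T → ∣ T ∣ ≡ suc t → (∀ u → u ∈ T → Conn v u) → Edge T

  HasComponentLargerThan : ℕ → Set
  HasComponentLargerThan m =
    ∃[ v ] (Vertex v × ∃[ C ] (m < ∣ C ∣ × (∀ u → u ∈ C → Conn v u)))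

isTriangleᵇ : {n : ℕ} → ℕ → ℕ → List (Subset n) → Bool
isTriangleᵇ r t S = rwiseIntᵇ r t S ∧ (∣ ⋂ S ∣ <ᵇ t)

N : {n : ℕ} → ℕ → ℕ → List (Subset n) → ℕ
N r t 𝓕 = length (filterᵇ (isTriangleᵇ r t) (combinations (suc r) 𝓕))

initSeg : (n m : ℕ) → Subset n
initSeg n m = tabulate (λ i → if toℕ i <ᵇ m then inside else outside)
  where open import Data.Bool using (if_then_else_)

𝓖 : (n k r t : ℕ) → List (Subset n)
𝓖 n k r t = filterᵇ (λ F → (∣ F ∣ ≡ᵇ k) ∧ (∣ F ∩ initSeg n (r + t) ∣ ≡ᵇ (r + t ∸ 1))) (allSubsets n)
  where open import Data.Nat using (_≡ᵇ_)

-- Take c = 2 and d = 1.  If a component C of the cover graph is a clique with more than r + t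
-- vertices, every (t+1)-subset of C is a t-cover, which forces each member of 𝓕 to miss at most
-- one point of C; so any r + 1 members still share |C| - (r + 1) ≥ t points and 𝓕 contains no
-- (r+1,t)-triangle.  Every member of 𝓖_{r,t} misses exactly one point of [r+t], so 𝓖_{r,t} is
-- r-wise t-intersecting, and once n ≥ 2k it contains the triangle formed by the r + 1 sets
-- ([r+t] ∖ {i}) ∪ B_i, i ∈ [r+1], where B_1 is a block of k - r - t + 1 points outside [r+t]
-- and B_i, i ≥ 2, is a second block of that size disjoint from it.

module Submission where

open import Defs
open import Data.Bool using (Bool; true; false; T; T?; _∧_)
open import Data.Bool.Properties using (T-∧)
open import Data.Fin.Subset
open import Data.Fin.Subset.Properties
open import Data.List using (List; []; _∷_; [_]; map; _++_; length; cartesianProductWith)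
open import Data.List.Membership.Propositional using (lose; find) renaming (_∈_ to _∈ₗ_)
open import Data.List.Membership.Propositional.Properties
  using (∈-++⁻; ∈-map⁻; ∈-concatMap⁻; ∈-++⁺ˡ; ∈-++⁺ʳ; ∈-map⁺; ∈-filter⁻)
open import Data.List.Properties
  using (map-∘; map-++; map-id; ++-identityʳ; cartesianProductWith-distribʳ-++
        ; length-map; length-++; filter-all; filter-some; filter-none)
open import Data.List.Relation.Binary.Sublist.Propositional
  using ([]; _∷_; _∷ʳ_; from∈; lookup) renaming (_⊆_ to _⊑_)
open import Data.List.Relation.Binary.Sublist.Propositional.Properties
  using (++⁺; ++⁺ˡ; map⁺; filter⁺; []⊆-universal)
open import Data.List.Relation.Unary.All as All using (All; []; _∷_)
import Data.List.Relation.Unary.All.Properties as All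
open import Data.List.Relation.Unary.Any using (here; there)
open import Data.Nat using (ℕ; zero; suc; _+_; _*_; _^_; _∸_; _≤_; _<_; z≤n; s≤s; _≤ᵇ_; _≡ᵇ_)
open import Data.Nat.Properties
open import Data.Nat.Tactic.RingSolver using (solve-∀)
open import Data.Product using (_×_; _,_; proj₁; proj₂; uncurry; ∃-syntax)
open import Data.Sum using (inj₁; inj₂)
open import Data.Vec using (_∷_; []; here) renaming (_++_ to _++ᵥ_)
open import Data.Vec.Properties using (zipWith-++)
open import Function using (_∘_; id; Equivalence)
open import Relation.Binary.PropositionalEquality hiding ([_])
open import Relation.Nullary using (yes; no; ¬_)

private variable
  A : Set
  xs ys : List A

∣p∩q∣+∣p∩∁q∣≡∣p∣ : ∀ {n} (p q : Subset n) → ∣ p ∩ q ∣ + ∣ p ∩ ∁ q ∣ ≡ ∣ p ∣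
∣p∩q∣+∣p∩∁q∣≡∣p∣ []          []          = refl
∣p∩q∣+∣p∩∁q∣≡∣p∣ (false ∷ p) (_ ∷ q)     = ∣p∩q∣+∣p∩∁q∣≡∣p∣ p q
∣p∩q∣+∣p∩∁q∣≡∣p∣ (true ∷ p)  (true ∷ q)  = cong suc (∣p∩q∣+∣p∩∁q∣≡∣p∣ p q)
∣p∩q∣+∣p∩∁q∣≡∣p∣ (true ∷ p)  (false ∷ q) =
  trans (+-suc ∣ p ∩ q ∣ _) (cong suc (∣p∩q∣+∣p∩∁q∣≡∣p∣ p q))

∣p∩∁⊤∣≡0 : ∀ {n} (p : Subset n) → ∣ p ∩ ∁ ⊤ ∣ ≡ 0
∣p∩∁⊤∣≡0 []          = refl
∣p∩∁⊤∣≡0 (false ∷ p) = ∣p∩∁⊤∣≡0 p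
∣p∩∁⊤∣≡0 (true ∷ p)  = ∣p∩∁⊤∣≡0 p

∣p∩∁[q∩r]∣≤∣p∩∁q∣+∣p∩∁r∣ : ∀ {n} (p q r : Subset n) →
  ∣ p ∩ ∁ (q ∩ r) ∣ ≤ ∣ p ∩ ∁ q ∣ + ∣ p ∩ ∁ r ∣
∣p∩∁[q∩r]∣≤∣p∩∁q∣+∣p∩∁r∣ []          []          []          = z≤n
∣p∩∁[q∩r]∣≤∣p∩∁q∣+∣p∩∁r∣ (false ∷ p) (_ ∷ q)     (_ ∷ r)     = ∣p∩∁[q∩r]∣≤∣p∩∁q∣+∣p∩∁r∣ p q r
∣p∩∁[q∩r]∣≤∣p∩∁q∣+∣p∩∁r∣ (true ∷ p)  (true ∷ q)  (true ∷ r)  = ∣p∩∁[q∩r]∣≤∣p∩∁q∣+∣p∩∁r∣ p q r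
∣p∩∁[q∩r]∣≤∣p∩∁q∣+∣p∩∁r∣ (true ∷ p)  (true ∷ q)  (false ∷ r) =
  ≤-trans (s≤s (∣p∩∁[q∩r]∣≤∣p∩∁q∣+∣p∩∁r∣ p q r)) (≤-reflexive (sym (+-suc ∣ p ∩ ∁ q ∣ _)))
∣p∩∁[q∩r]∣≤∣p∩∁q∣+∣p∩∁r∣ (true ∷ p)  (false ∷ q) (true ∷ r)  = s≤s (∣p∩∁[q∩r]∣≤∣p∩∁q∣+∣p∩∁r∣ p q r)
∣p∩∁[q∩r]∣≤∣p∩∁q∣+∣p∩∁r∣ (true ∷ p)  (false ∷ q) (false ∷ r) =
  s≤s (≤-trans (∣p∩∁[q∩r]∣≤∣p∩∁q∣+∣p∩∁r∣ p q r) (+-monoʳ-≤ ∣ p ∩ ∁ q ∣ (n≤1+n _)))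

∣p∩∁⋂xs∣≤length[xs]*d : ∀ {n} (p : Subset n) {d} {xs} → All (λ q → ∣ p ∩ ∁ q ∣ ≤ d) xs →
  ∣ p ∩ ∁ (⋂ xs) ∣ ≤ length xs * d
∣p∩∁⋂xs∣≤length[xs]*d p []                  = ≤-reflexive (∣p∩∁⊤∣≡0 p)
∣p∩∁⋂xs∣≤length[xs]*d p {d} {q ∷ xs} (pq ∷ pxs) = begin
  ∣ p ∩ ∁ (q ∩ ⋂ xs) ∣            ≤⟨ ∣p∩∁[q∩r]∣≤∣p∩∁q∣+∣p∩∁r∣ p q (⋂ xs) ⟩
  ∣ p ∩ ∁ q ∣ + ∣ p ∩ ∁ (⋂ xs) ∣  ≤⟨ +-mono-≤ pq (∣p∩∁⋂xs∣≤length[xs]*d p pxs) ⟩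
  d + length xs * d               ∎
  where open ≤-Reasoning

length+t≤∣p∣⇒t≤∣⋂xs∣ : ∀ {n} (p : Subset n) {t xs} → All (λ q → ∣ p ∩ ∁ q ∣ ≤ 1) xs →
  length xs + t ≤ ∣ p ∣ → t ≤ ∣ ⋂ xs ∣
length+t≤∣p∣⇒t≤∣⋂xs∣ p {t} {xs} misses large = +-cancelˡ-≤ (length xs) t ∣ ⋂ xs ∣ (begin
  length xs + t                             ≤⟨ large ⟩
  ∣ p ∣                                     ≡⟨ ∣p∩q∣+∣p∩∁q∣≡∣p∣ p (⋂ xs) ⟨
  ∣ p ∩ ⋂ xs ∣ + ∣ p ∩ ∁ (⋂ xs) ∣           ≤⟨ +-mono-≤ (∣p∩q∣≤∣q∣ p (⋂ xs)) (∣p∩∁⋂xs∣≤length[xs]*d p misses) ⟩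
  ∣ ⋂ xs ∣ + length xs * 1                  ≡⟨ cong (∣ ⋂ xs ∣ +_) (*-identityʳ (length xs)) ⟩
  ∣ ⋂ xs ∣ + length xs                      ≡⟨ +-comm ∣ ⋂ xs ∣ (length xs) ⟩
  length xs + ∣ ⋂ xs ∣                      ∎)
  where open ≤-Reasoning

∃-⊆-between : ∀ {n} {p q : Subset n} m → p ⊆ q → ∣ p ∣ ≤ m → m ≤ ∣ q ∣ →
  ∃[ r ] (p ⊆ r × r ⊆ q × ∣ r ∣ ≡ m)
∃-⊆-between {p = []}        {[]}        zero p⊆q _ _ = [] , p⊆q , p⊆q , refl
∃-⊆-between {p = true ∷ p}  {false ∷ q} m    p⊆q _ _ with () ← p⊆q here
∃-⊆-between {p = false ∷ p} {false ∷ q} m    p⊆q lo hi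
  with r , p⊆r , r⊆q , ∣r∣≡m ← ∃-⊆-between m (drop-∷-⊆ p⊆q) lo hi =
  false ∷ r , out⊆ p⊆r , out⊆ r⊆q , ∣r∣≡m
∃-⊆-between {p = true ∷ p}  {true ∷ q}  (suc m) p⊆q (s≤s lo) (s≤s hi)
  with r , p⊆r , r⊆q , ∣r∣≡m ← ∃-⊆-between m (drop-∷-⊆ p⊆q) lo hi =
  true ∷ r , s⊆s p⊆r , s⊆s r⊆q , cong suc ∣r∣≡m
∃-⊆-between {p = false ∷ p} {true ∷ q}  m    p⊆q lo hi with m ≤? ∣ q ∣
... | yes m≤∣q∣ with r , p⊆r , r⊆q , ∣r∣≡m ← ∃-⊆-between m (drop-∷-⊆ p⊆q) lo m≤∣q∣ =
  false ∷ r , out⊆ p⊆r , out⊆ r⊆q , ∣r∣≡m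
... | no m≰∣q∣ = true ∷ q , out⊆ (drop-∷-⊆ p⊆q) , ⊆-refl , ≤-antisym (≰⇒> m≰∣q∣) hi

-- A (t+1)-subset of p containing two points of p outside q would meet q in only t - 1 points.
all-[1+t]-subsets-meet⇒∣p∩∁q∣≤1 : ∀ {n t} (p q : Subset n) → 1 ≤ t → suc t ≤ ∣ p ∣ →
  (∀ r → ∣ r ∣ ≡ suc t → r ⊆ p → t ≤ ∣ r ∩ q ∣) → ∣ p ∩ ∁ q ∣ ≤ 1
all-[1+t]-subsets-meet⇒∣p∩∁q∣≤1 {n} {t} p q 1≤t t<∣p∣ meets = ≮⇒≥ ¬1<∣p∩∁q∣
  where
  ¬1<∣p∩∁q∣ : ¬ 1 < ∣ p ∩ ∁ q ∣
  ¬1<∣p∩∁q∣ 2≤∣p∩∁q∣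
    with s , _ , s⊆p∩∁q , ∣s∣≡2 ← ∃-⊆-between 2 ⊥⊆ (≤-trans (≤-reflexive (∣⊥∣≡0 n)) z≤n) 2≤∣p∩∁q∣
    with r , s⊆r , r⊆p , ∣r∣≡1+t ← ∃-⊆-between (suc t) (⊆-trans s⊆p∩∁q (p∩q⊆p p (∁ q)))
                                      (≤-trans (≤-reflexive ∣s∣≡2) (s≤s 1≤t)) t<∣p∣
    = <-irrefl refl (+-cancelˡ-≤ t 2 1 (begin
      t + 2                        ≤⟨ +-mono-≤ (meets r ∣r∣≡1+t r⊆p) (≤-trans (≤-reflexive (sym ∣s∣≡2)) (p⊆q⇒∣p∣≤∣q∣ s⊆r∩∁q)) ⟩
      ∣ r ∩ q ∣ + ∣ r ∩ ∁ q ∣      ≡⟨ ∣p∩q∣+∣p∩∁q∣≡∣p∣ r q ⟩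
      ∣ r ∣                        ≡⟨ ∣r∣≡1+t ⟩
      suc t                        ≡⟨ +-comm 1 t ⟩
      t + 1                        ∎))
    where
    open ≤-Reasoning
    s⊆r∩∁q : s ⊆ r ∩ ∁ q
    s⊆r∩∁q x∈s = x∈p∩q⁺ (s⊆r x∈s , proj₂ (x∈p∩q⁻ p (∁ q) (s⊆p∩∁q x∈s)))

∈-combinations⁻ : ∀ m → xs ∈ₗ combinations m ys → length xs ≡ m × xs ⊑ ys
∈-combinations⁻ {ys = ys}     zero    (here refl) = refl , []⊆-universal ys
∈-combinations⁻ {ys = y ∷ ys} (suc m) xs∈ with ∈-++⁻ (map (y ∷_) (combinations m ys)) xs∈
... | inj₁ xs∈y∷ with zs , zs∈ , refl ← ∈-map⁻ (y ∷_) xs∈y∷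
                 with len , zs⊑ys ← ∈-combinations⁻ m zs∈ = cong suc len , refl ∷ zs⊑ys
... | inj₂ xs∈′ with len , xs⊑ys ← ∈-combinations⁻ (suc m) xs∈′ = len , y ∷ʳ xs⊑ys

⊑⇒∈-combinations : xs ⊑ ys → xs ∈ₗ combinations (length xs) ys
⊑⇒∈-combinations []                     = here refl
⊑⇒∈-combinations {xs = []} (y ∷ʳ _)     = here refl
⊑⇒∈-combinations {xs = _ ∷ xs} (y ∷ʳ τ) = ∈-++⁺ʳ (map (y ∷_) (combinations (length xs) _)) (⊑⇒∈-combinations τ)
⊑⇒∈-combinations (refl ∷ τ)             = ∈-++⁺ˡ (∈-map⁺ _ (⊑⇒∈-combinations τ))

∈-tuples⁻ : ∀ m → xs ∈ₗ tuples m ys → length xs ≡ m × All (_∈ₗ ys) xs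
∈-tuples⁻         zero    (here refl) = refl , []
∈-tuples⁻ {ys = ys} (suc m) xs∈
  with y , y∈ys , xs∈y∷ ← find (∈-concatMap⁻ (λ y → map (y ∷_) (tuples m ys)) {xs = ys} xs∈)
  with zs , zs∈ , refl ← ∈-map⁻ (y ∷_) xs∈y∷
  with len , zs⊆ys ← ∈-tuples⁻ m zs∈ = cong suc len , y∈ys ∷ zs⊆ys

-- rwiseIntᵇ folds a where-bound function over the r-tuples, which can only be reached through its
-- defining equations; abstracting over tuples r 𝓕 in rwiseIntᵇ-complete lets Agda infer it as h.
T-fold-∧ : (g : A → Bool) (h : List A → Bool) → T (h []) → (∀ x xs → h (x ∷ xs) ≡ g x ∧ h xs) →
  ∀ xs → All (T ∘ g) xs → T (h xs)
T-fold-∧ g h h[] h∷ []       []         = h[]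
T-fold-∧ g h h[] h∷ (x ∷ xs) (gx ∷ gxs) =
  subst T (sym (h∷ x xs)) (Equivalence.from T-∧ (gx , T-fold-∧ g h h[] h∷ xs gxs))

rwiseIntᵇ-complete : ∀ {n} r t (𝓕 : List (Subset n)) → RWiseTIntersecting r t 𝓕 → T (rwiseIntᵇ r t 𝓕)
rwiseIntᵇ-complete r t 𝓕 int
  with tuples r 𝓕 | All.tabulate {xs = tuples r 𝓕} (λ S∈ → uncurry (int _) (∈-tuples⁻ r S∈))
     | T-fold-∧ (λ S → t ≤ᵇ ∣ ⋂ S ∣) _ _ (λ _ _ → refl)
... | Ss | intSs | fold = fold Ss (All.map ≤⇒≤ᵇ intSs)

allSubsets-complete : ∀ {n} (p : Subset n) → p ∈ₗ allSubsets n
allSubsets-complete []          = here refl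
allSubsets-complete (true ∷ p)  = ∈-++⁺ˡ (∈-map⁺ (true ∷_) (allSubsets-complete p))
allSubsets-complete (false ∷ p) = ∈-++⁺ʳ (map (true ∷_) (allSubsets _)) (∈-map⁺ (false ∷_) (allSubsets-complete p))

cartesianProductWith-++-map-∷ : ∀ {a b} x (ps : List (Subset a)) (qs : List (Subset b)) →
  cartesianProductWith _++ᵥ_ (map (x ∷_) ps) qs ≡ map (x ∷_) (cartesianProductWith _++ᵥ_ ps qs)
cartesianProductWith-++-map-∷ x []       qs = refl
cartesianProductWith-++-map-∷ x (p ∷ ps) qs = begin
  map ((x ∷_) ∘ (p ++ᵥ_)) qs ++ cartesianProductWith _++ᵥ_ (map (x ∷_) ps) qs
    ≡⟨ cong₂ _++_ (map-∘ qs) (cartesianProductWith-++-map-∷ x ps qs) ⟩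
  map (x ∷_) (map (p ++ᵥ_) qs) ++ map (x ∷_) (cartesianProductWith _++ᵥ_ ps qs)
    ≡⟨ map-++ (x ∷_) (map (p ++ᵥ_) qs) _ ⟨
  map (x ∷_) (map (p ++ᵥ_) qs ++ cartesianProductWith _++ᵥ_ ps qs) ∎
  where open ≡-Reasoning

allSubsets-+ : ∀ a b → allSubsets (a + b) ≡ cartesianProductWith _++ᵥ_ (allSubsets a) (allSubsets b)
allSubsets-+ zero    b = sym (trans (++-identityʳ _) (map-id (allSubsets b)))
allSubsets-+ (suc a) b = begin
  map (true ∷_) (allSubsets (a + b)) ++ map (false ∷_) (allSubsets (a + b))
    ≡⟨ cong₂ (λ ps qs → map (true ∷_) ps ++ map (false ∷_) qs) (allSubsets-+ a b) (allSubsets-+ a b) ⟩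
  map (true ∷_) (prod (allSubsets a) (allSubsets b)) ++ map (false ∷_) (prod (allSubsets a) (allSubsets b))
    ≡⟨ cong₂ _++_ (cartesianProductWith-++-map-∷ true (allSubsets a) (allSubsets b))
                  (cartesianProductWith-++-map-∷ false (allSubsets a) (allSubsets b)) ⟨
  prod (map (true ∷_) (allSubsets a)) (allSubsets b) ++ prod (map (false ∷_) (allSubsets a)) (allSubsets b)
    ≡⟨ cartesianProductWith-distribʳ-++ _++ᵥ_ (map (true ∷_) (allSubsets a)) _ (allSubsets b) ⟨
  prod (allSubsets (suc a)) (allSubsets b) ∎
  where
  open ≡-Reasoning
  prod : ∀ {k l} → List (Subset k) → List (Subset l) → List (Subset (k + l))
  prod = cartesianProductWith _++ᵥ_

map-⊑-cartesianProductWith : ∀ {B C : Set} (f : A → B → C) {g : A → B} {us : List A} {ys : List B} →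
  us ⊑ xs → (∀ u → g u ∈ₗ ys) → map (λ u → f u (g u)) us ⊑ cartesianProductWith f xs ys
map-⊑-cartesianProductWith f []               g∈ = []⊆-universal _
map-⊑-cartesianProductWith f (x ∷ʳ τ)         g∈ = ++⁺ˡ _ (map-⊑-cartesianProductWith f τ g∈)
map-⊑-cartesianProductWith f (_∷_ {x} refl τ) g∈ = ++⁺ (from∈ (∈-map⁺ (f x) (g∈ x))) (map-⊑-cartesianProductWith f τ g∈)

∣p++q∣≡∣p∣+∣q∣ : ∀ {a b} (p : Subset a) (q : Subset b) → ∣ p ++ᵥ q ∣ ≡ ∣ p ∣ + ∣ q ∣
∣p++q∣≡∣p∣+∣q∣ []          q = refl
∣p++q∣≡∣p∣+∣q∣ (true ∷ p)  q = cong suc (∣p++q∣≡∣p∣+∣q∣ p q)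
∣p++q∣≡∣p∣+∣q∣ (false ∷ p) q = ∣p++q∣≡∣p∣+∣q∣ p q

⊤-+ : ∀ a b → ⊤ {a + b} ≡ ⊤ {a} ++ᵥ ⊤ {b}
⊤-+ zero    b = refl
⊤-+ (suc a) b = cong (true ∷_) (⊤-+ a b)

⋂-++ : ∀ {n} (ps qs : List (Subset n)) → ⋂ (ps ++ qs) ≡ ⋂ ps ∩ ⋂ qs
⋂-++ []       qs = sym (∩-identityˡ (⋂ qs))
⋂-++ (p ∷ ps) qs = trans (cong (p ∩_) (⋂-++ ps qs)) (sym (∩-assoc p (⋂ ps) (⋂ qs)))

⋂-map-true∷ : ∀ {n} (ps : List (Subset n)) → ⋂ (map (true ∷_) ps) ≡ true ∷ ⋂ ps
⋂-map-true∷ []       = refl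
⋂-map-true∷ (p ∷ ps) = cong ((true ∷ p) ∩_) (⋂-map-true∷ ps)

⋂-map-++ : ∀ {a b} (g : Subset a → Subset b) (ps : List (Subset a)) →
  ⋂ (map (λ p → p ++ᵥ g p) ps) ≡ ⋂ ps ++ᵥ ⋂ (map g ps)
⋂-map-++ {a} {b} g []       = ⊤-+ a b
⋂-map-++ g (p ∷ ps) = trans (cong ((p ++ᵥ g p) ∩_) (⋂-map-++ g ps)) (zipWith-++ _∧_ p (g p) _ _)

⋂-⊆ : ∀ {n} {p : Subset n} {ps} → p ∈ₗ ps → ⋂ ps ⊆ p
⋂-⊆ {ps = p ∷ ps} (here refl) = p∩q⊆p p (⋂ ps)
⋂-⊆ {ps = q ∷ ps} (there p∈)  = ⊆-trans (p∩q⊆q q (⋂ ps)) (⋂-⊆ p∈)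

initSeg-0 : ∀ n → initSeg n 0 ≡ ⊥
initSeg-0 zero    = refl
initSeg-0 (suc n) = cong (false ∷_) (initSeg-0 n)

initSeg-+ : ∀ a b → initSeg (a + b) a ≡ ⊤ {a} ++ᵥ ⊥ {b}
initSeg-+ zero    b = initSeg-0 b
initSeg-+ (suc a) b = cong (true ∷_) (initSeg-+ a b)

∣[p++q]∩[⊤++⊥]∣≡∣p∣ : ∀ {a b} (p : Subset a) (q : Subset b) → ∣ (p ++ᵥ q) ∩ (⊤ {a} ++ᵥ ⊥ {b}) ∣ ≡ ∣ p ∣
∣[p++q]∩[⊤++⊥]∣≡∣p∣ {a} {b} p q = begin
  ∣ (p ++ᵥ q) ∩ (⊤ {a} ++ᵥ ⊥) ∣   ≡⟨ cong ∣_∣ (zipWith-++ _∧_ p q ⊤ ⊥) ⟩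
  ∣ (p ∩ ⊤) ++ᵥ (q ∩ ⊥) ∣       ≡⟨ cong₂ (λ x y → ∣ x ++ᵥ y ∣) (∩-identityʳ p) (∩-zeroʳ q) ⟩
  ∣ p ++ᵥ ⊥ ∣                   ≡⟨ ∣p++q∣≡∣p∣+∣q∣ p ⊥ ⟩
  ∣ p ∣ + ∣ ⊥ {b} ∣             ≡⟨ cong (∣ p ∣ +_) (∣⊥∣≡0 b) ⟩
  ∣ p ∣ + 0                     ≡⟨ +-identityʳ ∣ p ∣ ⟩
  ∣ p ∣                         ∎
  where open ≡-Reasoning

𝓖-condition : (n k r t : ℕ) → Subset n → Set
𝓖-condition n k r t F = ∣ F ∣ ≡ k × ∣ F ∩ initSeg n (r + t) ∣ ≡ r + t ∸ 1

module _ {n k r t : ℕ} where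

  private
    𝓖ᵇ : Subset n → Bool
    𝓖ᵇ F = (∣ F ∣ ≡ᵇ k) ∧ (∣ F ∩ initSeg n (r + t) ∣ ≡ᵇ (r + t ∸ 1))

  ∈-𝓖⁻ : ∀ {F} → F ∈ₗ 𝓖 n k r t → 𝓖-condition n k r t F
  ∈-𝓖⁻ {F} F∈ with size , trace ← Equivalence.to T-∧ (proj₂ (∈-filter⁻ (T? ∘ 𝓖ᵇ) {xs = allSubsets n} F∈)) =
    ≡ᵇ⇒≡ ∣ F ∣ k size , ≡ᵇ⇒≡ _ _ trace

  ⊑-𝓖 : ∀ {S} → S ⊑ allSubsets n → All (𝓖-condition n k r t) S → S ⊑ 𝓖 n k r t
  ⊑-𝓖 {S} τ conditions = subst (_⊑ 𝓖 n k r t) (filter-all (T? ∘ 𝓖ᵇ) {xs = S} (All.map (λ {F} → 𝓖ᵇ-complete {F}) conditions))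
                                (filter⁺ (T? ∘ 𝓖ᵇ) (T? ∘ 𝓖ᵇ) {as = S} {bs = allSubsets n} (λ { refl → id }) τ)
    where
    𝓖ᵇ-complete : ∀ {F} → 𝓖-condition n k r t F → T (𝓖ᵇ F)
    𝓖ᵇ-complete (size , trace) = Equivalence.from T-∧ (≡⇒≡ᵇ _ _ size , ≡⇒≡ᵇ _ _ trace)

m≡o∸1⇒m+n≡o⇒n≤1 : ∀ {m n} o → m ≡ o ∸ 1 → m + n ≡ o → n ≤ 1
m≡o∸1⇒m+n≡o⇒n≤1 {m} zero    _    m+n≡0 = m≤n⇒m≤1+n (≤-reflexive (m+n≡0⇒n≡0 m m+n≡0))
m≡o∸1⇒m+n≡o⇒n≤1 {n = n} (suc o) refl o+n≡1+o = ≤-reflexive (+-cancelˡ-≡ o n 1 (trans o+n≡1+o (+-comm 1 o)))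

∣⊤++⊥∣ : ∀ a b → ∣ ⊤ {a} ++ᵥ ⊥ {b} ∣ ≡ a
∣⊤++⊥∣ a b = trans (∣p++q∣≡∣p∣+∣q∣ (⊤ {a}) (⊥ {b})) (trans (cong₂ _+_ (∣⊤∣≡n a) (∣⊥∣≡0 b)) (+-identityʳ a))

𝓖-rwise : ∀ r t b k → RWiseTIntersecting r t (𝓖 ((r + t) + b) k r t)
𝓖-rwise r t b k S ∣S∣≡r S⊆𝓖 =
  length+t≤∣p∣⇒t≤∣⋂xs∣ C (All.map misses-one S⊆𝓖) (≤-reflexive (trans (cong (_+ t) ∣S∣≡r) (sym ∣C∣≡r+t)))
  where
  C : Subset ((r + t) + b)
  C = initSeg ((r + t) + b) (r + t)
  ∣C∣≡r+t : ∣ C ∣ ≡ r + t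
  ∣C∣≡r+t = trans (cong ∣_∣ (initSeg-+ (r + t) b)) (∣⊤++⊥∣ (r + t) b)
  misses-one : ∀ {F} → F ∈ₗ 𝓖 ((r + t) + b) k r t → ∣ C ∩ ∁ F ∣ ≤ 1
  misses-one {F} F∈𝓖 = m≡o∸1⇒m+n≡o⇒n≤1 (r + t)
    (trans (cong ∣_∣ (∩-comm C F)) (proj₂ (∈-𝓖⁻ {k = k} {r} {t} F∈𝓖)))
    (trans (∣p∩q∣+∣p∩∁q∣≡∣p∣ C F) ∣C∣≡r+t)

-- The sets [r + 1 + t] ∖ {i}, i ≤ r, in the order in which allSubsets lists them.
coSingletons : ∀ r t → List (Subset (r + suc t))
coSingletons zero    t = [ false ∷ ⊤ ]
coSingletons (suc r) t = map (true ∷_) (coSingletons r t) ++ [ false ∷ ⊤ ]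

length-coSingletons : ∀ r t → length (coSingletons r t) ≡ suc r
length-coSingletons zero    t = refl
length-coSingletons (suc r) t = begin
  length (map (true ∷_) (coSingletons r t) ++ [ false ∷ ⊤ ]) ≡⟨ length-++ (map (true ∷_) (coSingletons r t)) ⟩
  length (map (true ∷_) (coSingletons r t)) + 1              ≡⟨ cong (_+ 1) (length-map (true ∷_) (coSingletons r t)) ⟩
  length (coSingletons r t) + 1                              ≡⟨ cong (_+ 1) (length-coSingletons r t) ⟩
  suc r + 1                                                  ≡⟨ +-comm (suc r) 1 ⟩
  suc (suc r)                                                ∎
  where open ≡-Reasoning

∣coSingleton∣ : ∀ r t {u} → u ∈ₗ coSingletons r t → ∣ u ∣ ≡ r + t
∣coSingleton∣ zero    t (here refl) = ∣⊤∣≡n t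
∣coSingleton∣ (suc r) t u∈ with ∈-++⁻ (map (true ∷_) (coSingletons r t)) u∈
... | inj₁ u∈true∷ with w , w∈ , refl ← ∈-map⁻ (true ∷_) u∈true∷ = cong suc (∣coSingleton∣ r t w∈)
... | inj₂ (here refl) = trans (∣⊤∣≡n (r + suc t)) (+-suc r t)

∣⋂coSingletons∣ : ∀ r t → ∣ ⋂ (coSingletons r t) ∣ ≡ t
∣⋂coSingletons∣ zero    t = trans (cong ∣_∣ (∩-identityʳ (⊤ {t}))) (∣⊤∣≡n t)
∣⋂coSingletons∣ (suc r) t = begin
  ∣ ⋂ (map (true ∷_) (coSingletons r t) ++ [ false ∷ ⊤ ]) ∣   ≡⟨ cong ∣_∣ (⋂-++ (map (true ∷_) (coSingletons r t)) _) ⟩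
  ∣ ⋂ (map (true ∷_) (coSingletons r t)) ∩ ((false ∷ ⊤) ∩ ⊤) ∣ ≡⟨ cong (λ p → ∣ p ∩ ((false ∷ ⊤) ∩ ⊤) ∣) (⋂-map-true∷ (coSingletons r t)) ⟩
  ∣ ⋂ (coSingletons r t) ∩ (⊤ ∩ ⊤) ∣                           ≡⟨ cong (λ p → ∣ ⋂ (coSingletons r t) ∩ p ∣) (∩-identityʳ (⊤ {r + suc t})) ⟩
  ∣ ⋂ (coSingletons r t) ∩ ⊤ ∣                                 ≡⟨ cong ∣_∣ (∩-identityʳ (⋂ (coSingletons r t))) ⟩
  ∣ ⋂ (coSingletons r t) ∣                                     ≡⟨ ∣⋂coSingletons∣ r t ⟩
  t                                                            ∎
  where open ≡-Reasoning

[false∷⊤]⊑map-false∷-allSubsets : ∀ n → [ false ∷ ⊤ {n} ] ⊑ map (false ∷_) (allSubsets n)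
[false∷⊤]⊑map-false∷-allSubsets n = from∈ (∈-map⁺ (false ∷_) (allSubsets-complete ⊤))

coSingletons-⊑-allSubsets : ∀ r t → coSingletons r t ⊑ allSubsets (r + suc t)
coSingletons-⊑-allSubsets zero    t = ++⁺ˡ (map (true ∷_) (allSubsets t)) ([false∷⊤]⊑map-false∷-allSubsets t)
coSingletons-⊑-allSubsets (suc r) t =
  ++⁺ (map⁺ (true ∷_) (coSingletons-⊑-allSubsets r t)) ([false∷⊤]⊑map-false∷-allSubsets (r + suc t))

∃-∈-coSingletons : ∀ r t → ∃[ u ] u ∈ₗ coSingletons r t
∃-∈-coSingletons zero    t = _ , here refl
∃-∈-coSingletons (suc r) t with u , u∈ ← ∃-∈-coSingletons r t = true ∷ u , ∈-++⁺ˡ (∈-map⁺ (true ∷_) u∈)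

module Triangle (e m : ℕ) where

  left-block right-block : Subset (e + (e + m))
  left-block  = ⊤ {e} ++ᵥ ⊥ {e + m}
  right-block = ⊥ {e} ++ᵥ ⊤ {e} ++ᵥ ⊥ {m}

  tail-block : ∀ {a} → Subset (suc a) → Subset (e + (e + m))
  tail-block (true ∷ _)  = left-block
  tail-block (false ∷ _) = right-block

  ∣tail-block∣ : ∀ {a} (u : Subset (suc a)) → ∣ tail-block u ∣ ≡ e
  ∣tail-block∣ (true ∷ _)  = ∣⊤++⊥∣ e (e + m)
  ∣tail-block∣ (false ∷ _) = trans (∣p++q∣≡∣p∣+∣q∣ (⊥ {e}) (⊤ {e} ++ᵥ ⊥ {m})) (cong₂ _+_ (∣⊥∣≡0 e) (∣⊤++⊥∣ e m))

  ∣left-block∩right-block∣≡0 : ∣ left-block ∩ right-block ∣ ≡ 0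
  ∣left-block∩right-block∣≡0 = begin
    ∣ left-block ∩ right-block ∣              ≡⟨ cong ∣_∣ (zipWith-++ _∧_ (⊤ {e}) (⊥ {e + m}) ⊥ (⊤ {e} ++ᵥ ⊥ {m})) ⟩
    ∣ (⊤ {e} ∩ ⊥) ++ᵥ (⊥ ∩ (⊤ {e} ++ᵥ ⊥ {m})) ∣ ≡⟨ cong₂ (λ p q → ∣ p ++ᵥ q ∣) (∩-zeroʳ (⊤ {e})) (∩-zeroˡ (⊤ {e} ++ᵥ ⊥ {m})) ⟩
    ∣ ⊥ {e} ++ᵥ ⊥ {e + m} ∣                   ≡⟨ ∣p++q∣≡∣p∣+∣q∣ (⊥ {e}) (⊥ {e + m}) ⟩
    ∣ ⊥ {e} ∣ + ∣ ⊥ {e + m} ∣                 ≡⟨ cong₂ _+_ (∣⊥∣≡0 e) (∣⊥∣≡0 (e + m)) ⟩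
    0                                         ∎
    where open ≡-Reasoning

  -- r and t here are one less than in the theorem.
  module _ (r t : ℕ) where

    n k : ℕ
    n = (suc r + suc t) + (e + (e + m))
    k = (suc r + t) + e

    triangle : List (Subset n)
    triangle = map (λ u → u ++ᵥ tail-block u) (coSingletons (suc r) t)

    length-triangle : length triangle ≡ suc (suc r)
    length-triangle = trans (length-map _ (coSingletons (suc r) t)) (length-coSingletons (suc r) t)

    triangle-⊑-allSubsets : triangle ⊑ allSubsets n
    triangle-⊑-allSubsets = subst (triangle ⊑_) (sym (allSubsets-+ (suc r + suc t) (e + (e + m))))
      (map-⊑-cartesianProductWith _++ᵥ_ (coSingletons-⊑-allSubsets (suc r) t) (allSubsets-complete ∘ tail-block))

    triangle-⊑-𝓖 : triangle ⊑ 𝓖 n k (suc r) (suc t)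
    triangle-⊑-𝓖 = ⊑-𝓖 {n} {k} {suc r} {suc t} triangle-⊑-allSubsets (All.map⁺ (All.tabulate 𝓖-condition-∷))
      where
      𝓖-condition-∷ : ∀ {u} → u ∈ₗ coSingletons (suc r) t → 𝓖-condition n k (suc r) (suc t) (u ++ᵥ tail-block u)
      𝓖-condition-∷ {u} u∈ =
        trans (∣p++q∣≡∣p∣+∣q∣ u (tail-block u)) (cong₂ _+_ (∣coSingleton∣ (suc r) t u∈) (∣tail-block∣ u)) ,
        (begin
          ∣ (u ++ᵥ tail-block u) ∩ initSeg n (suc r + suc t) ∣ ≡⟨ cong (λ p → ∣ (u ++ᵥ tail-block u) ∩ p ∣) (initSeg-+ (suc r + suc t) (e + (e + m))) ⟩
          ∣ (u ++ᵥ tail-block u) ∩ (⊤ {suc r + suc t} ++ᵥ ⊥) ∣ ≡⟨ ∣[p++q]∩[⊤++⊥]∣≡∣p∣ u (tail-block u) ⟩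
          ∣ u ∣                                               ≡⟨ ∣coSingleton∣ (suc r) t u∈ ⟩
          suc (r + t)                                         ≡⟨ +-suc r t ⟨
          r + suc t                                           ∎)
        where open ≡-Reasoning

    ∣⋂triangle∣≤t : ∣ ⋂ triangle ∣ ≤ t
    ∣⋂triangle∣≤t = begin
      ∣ ⋂ triangle ∣                                    ≡⟨ cong ∣_∣ (⋂-map-++ tail-block (coSingletons (suc r) t)) ⟩
      ∣ ⋂ (coSingletons (suc r) t) ++ᵥ ⋂ tails ∣        ≡⟨ ∣p++q∣≡∣p∣+∣q∣ (⋂ (coSingletons (suc r) t)) (⋂ tails) ⟩
      ∣ ⋂ (coSingletons (suc r) t) ∣ + ∣ ⋂ tails ∣      ≤⟨ +-mono-≤ (≤-reflexive (∣⋂coSingletons∣ (suc r) t)) ∣⋂tails∣≤0 ⟩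
      t + 0                                             ≡⟨ +-identityʳ t ⟩
      t                                                 ∎
      where
      open ≤-Reasoning
      tails : List (Subset (e + (e + m)))
      tails = map tail-block (coSingletons (suc r) t)
      left∈tails : left-block ∈ₗ tails
      left∈tails with u , u∈ ← ∃-∈-coSingletons r t = ∈-map⁺ tail-block (∈-++⁺ˡ (∈-map⁺ (true ∷_) u∈))
      right∈tails : right-block ∈ₗ tails
      right∈tails = ∈-map⁺ tail-block (∈-++⁺ʳ (map (true ∷_) (coSingletons r t)) (here refl))
      ∣⋂tails∣≤0 : ∣ ⋂ tails ∣ ≤ 0
      ∣⋂tails∣≤0 = ≤-trans (p⊆q⇒∣p∣≤∣q∣ (λ x∈ → x∈p∩q⁺ (⋂-⊆ left∈tails x∈ , ⋂-⊆ right∈tails x∈)))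
                            (≤-reflexive ∣left-block∩right-block∣≡0)

    triangle-isTriangle : T (isTriangleᵇ (suc r) (suc t) triangle)
    triangle-isTriangle = Equivalence.from T-∧
      ( rwiseIntᵇ-complete (suc r) (suc t) triangle
          (λ S ∣S∣≡r S∈ → 𝓖-rwise (suc r) (suc t) (e + (e + m)) k S ∣S∣≡r (All.map (lookup triangle-⊑-𝓖) S∈))
      , <⇒<ᵇ (s≤s ∣⋂triangle∣≤t))

    0<N[𝓖] : 0 < N (suc r) (suc t) (𝓖 n k (suc r) (suc t))
    0<N[𝓖] = filter-some (T? ∘ isTriangleᵇ (suc r) (suc t))
      (lose (subst (λ l → triangle ∈ₗ combinations l (𝓖 n k (suc r) (suc t))) length-triangle (⊑⇒∈-combinations triangle-⊑-𝓖))
            triangle-isTriangle)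

large-clique-component⇒N≡0 : ∀ {n} r t (𝓕 : List (Subset n)) → 1 ≤ t →
  CoverGraph.AllComponentsCliques t 𝓕 → CoverGraph.HasComponentLargerThan t 𝓕 (r + t) → N r t 𝓕 ≡ 0
large-clique-component⇒N≡0 r t 𝓕 1≤t cliques (v , v-vertex , C , r+t<∣C∣ , C-connected) =
  cong length (filter-none (T? ∘ isTriangleᵇ r t) (All.tabulate ¬triangle))
  where
  misses-one : ∀ {F} → F ∈ₗ 𝓕 → ∣ C ∩ ∁ F ∣ ≤ 1
  misses-one F∈𝓕 = all-[1+t]-subsets-meet⇒∣p∩∁q∣≤1 C _ 1≤t (≤-trans (s≤s (m≤n+m t r)) r+t<∣C∣)
    (λ T ∣T∣≡1+t T⊆C → All.lookup (proj₁ (cliques v v-vertex T ∣T∣≡1+t (λ u u∈T → C-connected u (T⊆C u∈T)))) F∈𝓕)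
  ¬triangle : ∀ {S} → S ∈ₗ combinations (suc r) 𝓕 → ¬ T (isTriangleᵇ r t S)
  ¬triangle {S} S∈ triangle with ∣S∣≡1+r , S⊑𝓕 ← ∈-combinations⁻ (suc r) S∈ =
    <⇒≱ (<ᵇ⇒< ∣ ⋂ S ∣ t (proj₂ (Equivalence.to T-∧ triangle)))
        (length+t≤∣p∣⇒t≤∣⋂xs∣ C (All.tabulate (misses-one ∘ lookup S⊑𝓕))
          (subst (λ l → l + t ≤ ∣ C ∣) (sym ∣S∣≡1+r) r+t<∣C∣))

2*k^1≡k+k : ∀ k → 2 * k ^ 1 ≡ k + k
2*k^1≡k+k k = cong₂ _+_ (*-identityʳ k) (trans (+-identityʳ (k * 1)) (*-identityʳ k))

[r+t]+2e≤2[r+t-1+e] : ∀ r t e → (suc r + suc t) + (e + e) ≤ ((suc r + t) + e) + ((suc r + t) + e)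
[r+t]+2e≤2[r+t-1+e] r t e = begin
  (suc r + suc t) + (e + e)         ≡⟨ cong (_+ (e + e)) (trans (+-suc (suc r) t) (+-comm 1 (suc r + t))) ⟩
  (suc r + t + 1) + (e + e)         ≤⟨ +-monoˡ-≤ (e + e) (+-monoʳ-≤ (suc r + t) (s≤s z≤n)) ⟩
  (suc r + t + (suc r + t)) + (e + e) ≡⟨ interchange (suc r + t) e ⟩
  (suc r + t + e) + (suc r + t + e) ∎
  where
  open ≤-Reasoning
  interchange : ∀ x y → (x + x) + (y + y) ≡ (x + y) + (x + y)
  interchange = solve-∀

k+k≤n⇒∃-blocks : ∀ r t k n → suc r + suc t ≤ k → k + k ≤ n →
  ∃[ e ] ∃[ m ] (k ≡ (suc r + t) + e × n ≡ (suc r + suc t) + (e + (e + m)))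
k+k≤n⇒∃-blocks r t k n r+t≤k k+k≤n
  with e , refl ← m≤n⇒∃[o]m+o≡n (≤-trans (+-monoʳ-≤ (suc r) (n≤1+n t)) r+t≤k)
  with m , refl ← m≤n⇒∃[o]m+o≡n (≤-trans ([r+t]+2e≤2[r+t-1+e] r t e) k+k≤n)
  = e , m , refl , trans (+-assoc (suc r + suc t) (e + e) m) (cong (suc r + suc t +_) (+-assoc e e m))

0<N[𝓖] : ∀ r t k n → suc r + suc t ≤ k → k + k ≤ n → 0 < N (suc r) (suc t) (𝓖 n k (suc r) (suc t))
0<N[𝓖] r t k n r+t≤k k+k≤n with e , m , refl , refl ← k+k≤n⇒∃-blocks r t k n r+t≤k k+k≤n =
  Triangle.0<N[𝓖] e m r t

lemma4p5 : ∀ (r t : ℕ) → 3 ≤ r → 2 ≤ t →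
    ∃[ c ] ∃[ d ] (1 ≤ c × 1 ≤ d ×
      (∀ (k n : ℕ) → r + t ≤ k → c * k ^ d ≤ n →
        ∀ (𝓕 : List (Subset n)) →
        IsKUniformFamily n k 𝓕 →
        RWiseTIntersecting r t 𝓕 →
        TauEq t 𝓕 (suc t) →
        CoverGraph.AllComponentsCliques t 𝓕 →
        CoverGraph.HasComponentLargerThan t 𝓕 (r + t) →
        N r t 𝓕 < N r t (𝓖 n k r t)))
lemma4p5 (suc r) (suc t) _ _ = 2 , 1 , s≤s z≤n , s≤s z≤n ,
  λ k n r+t≤k 2k≤n 𝓕 _ _ _ cliques large → begin-strict
    N (suc r) (suc t) 𝓕                  ≡⟨ large-clique-component⇒N≡0 (suc r) (suc t) 𝓕 (s≤s z≤n) cliques large ⟩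
    0                                    <⟨ 0<N[𝓖] r t k n r+t≤k (subst (_≤ n) (2*k^1≡k+k k) 2k≤n) ⟩
    N (suc r) (suc t) (𝓖 n k (suc r) (suc t)) ∎
  where open ≤-Reasoning
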